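{- In a singleton-free $(\ell-1)$-hike in a graph, at least half of all steps are stale. Consequently there are fewer than $\ell$ fresh steps.
   Context: An $(\ell-1)$-hike in a graph $G$ is a closed walk of exactly $2(\ell-1)$ steps which is non-backtracking except possibly between the $(\ell-1)$th and $\ell$th steps; it is singleton-free if every undirected edge it traverses is traversed at least twice. The steps are classified in order as follows (the initial vertex counts as previously visited): a step is stale if it traverses an edge already traversed earlier in the hike (in either direction); otherwise it is fresh if it steps to a previously unvisited vertex; otherwise it is a boundary step. -}

module Defs where

open import Data.Nat using (ℕ; zero; suc; _+_; _*_; _≤_; _<_)
open import Data.Fin using (Fin)
open import Data.Fin.Properties using (_≟_)
open import Data.Bool using (Bool; true; false; _∧_; _∨_; not)
open import Data.Product using (Σ; _×_; _,_)
open import Data.Sum using (_⊎_)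
open import Data.Empty using (⊥)
open import Relation.Nullary using (¬_)
open import Relation.Nullary.Decidable using (⌊_⌋)
open import Relation.Binary.PropositionalEquality using (_≡_; _≢_)

record Graph (n : ℕ) : Set₁ where
  field
    Adj    : Fin n → Fin n → Set
    sym    : ∀ {u v} → Adj u v → Adj v u
    irrefl : ∀ {u} → ¬ Adj u u

-- A walk is a vertex sequence w 0, w 1, …; a walk of m steps uses w 0 … w m,
-- step i (0-indexed, i < m) goes from w i to w (suc i).
Walk : ℕ → Set
Walk n = ℕ → Fin n

module _ {n : ℕ} (G : Graph n) where
  open Graph G

  IsClosedWalk : ℕ → Walk n → Set
  IsClosedWalk m w = (w 0 ≡ w m) × (∀ i → i < m → Adj (w i) (w (suc i)))

  -- (ℓ-1)-hike with k = ℓ - 1: closed walk of 2k steps, non-backtracking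
  -- (step i+1 does not reverse step i) except between the k-th and
  -- (k+1)-th steps (1-indexed), i.e. 0-indexed steps k-1 and k.
  IsHike : ℕ → Walk n → Set
  IsHike k w = IsClosedWalk (k + k) w
             × (∀ i → suc (suc i) ≤ k + k → suc i ≢ k → w (suc (suc i)) ≢ w i)

SameEdge : ∀ {n} → Walk n → ℕ → ℕ → Set
SameEdge w i j = (w i ≡ w j × w (suc i) ≡ w (suc j))
               ⊎ (w i ≡ w (suc j) × w (suc i) ≡ w j)

SingletonFree : ∀ {n} → ℕ → Walk n → Set
SingletonFree m w = ∀ i → i < m → Σ ℕ λ j → j < m × j ≢ i × SameEdge w i j

anyBelow : ℕ → (ℕ → Bool) → Bool
anyBelow zero    p = false
anyBelow (suc m) p = anyBelow m p ∨ p m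

count : ℕ → (ℕ → Bool) → ℕ
count zero    p = zero
count (suc m) p with p m
... | true  = suc (count m p)
... | false = count m p

sameEdgeᵇ : ∀ {n} → Walk n → ℕ → ℕ → Bool
sameEdgeᵇ w i j = (⌊ w i ≟ w j ⌋ ∧ ⌊ w (suc i) ≟ w (suc j) ⌋)
                ∨ (⌊ w i ≟ w (suc j) ⌋ ∧ ⌊ w (suc i) ≟ w j ⌋)

isStale : ∀ {n} → Walk n → ℕ → Bool
isStale w i = anyBelow i (λ j → sameEdgeᵇ w j i)

isFresh : ∀ {n} → Walk n → ℕ → Bool
isFresh w i = not (isStale w i)
            ∧ not (anyBelow (suc i) (λ j → ⌊ w j ≟ w (suc i) ⌋))

isBoundary : ∀ {n} → Walk n → ℕ → Bool
isBoundary w i = not (isStale w i) ∧ not (isFresh w i)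

staleCount : ∀ {n} → ℕ → Walk n → ℕ
staleCount m w = count m (isStale w)

freshCount : ∀ {n} → ℕ → Walk n → ℕ
freshCount m w = count m (isFresh w)

-- A step that is not stale is the first traversal of its edge. Singleton-freeness
-- gives a later traversal of that edge, which is stale, and first traversals of
-- different edges get different later traversals. Hence there are at least as many
-- stale steps as non-stale ones, i.e. at least half of the 2k steps are stale; as
-- fresh steps are not stale, there are at most k of them.
module Submission where

open import Defs
open import Data.Nat using (ℕ; zero; suc; _+_; _*_; _≤_; _<_; z≤n; s≤s)
open import Data.Nat.Properties
  using (m≤n⇒m<n∨m≡n; <-cmp; +-suc; +-identityʳ; +-monoˡ-≤; +-monoʳ-≤; +-mono-<; <⇒≱; ≰⇒>;
         _≤?_; module ≤-Reasoning)
open import Data.Product using (Σ; ∃; _×_; _,_; proj₁)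
open import Data.Sum using (inj₁; inj₂)
open import Data.Bool using (Bool; true; false; T; T?; not; _∧_; _∨_)
open import Data.Bool.Properties using (T-∧)
open import Data.List using (List; []; _∷_; length; filterᵇ; downFrom)
open import Data.List.Membership.Propositional using (_∈_)
open import Data.List.Membership.Propositional.Properties
  using (∈-filter⁺; ∈-filter⁻; ∈-downFrom⁺; ∈-downFrom⁻)
open import Data.List.Relation.Unary.Any using (here; there)
open import Data.List.Relation.Unary.All using (lookup)
open import Data.List.Relation.Unary.AllPairs using (_∷_)
open import Data.List.Relation.Unary.Unique.Propositional using (Unique)
open import Data.List.Relation.Unary.Unique.Propositional.Properties using (filter⁺; downFrom⁺)
open import Data.Fin.Properties using (_≟_)
open import Function using (_∘_)
open import Function.Bundles using (Equivalence)
open import Relation.Nullary using (¬_; Dec; yes; no; contradiction)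
open import Relation.Nullary.Decidable using (⌊_⌋)
open import Relation.Binary.Definitions using (tri<; tri≈; tri>)
open import Relation.Binary.PropositionalEquality
  using (_≡_; _≢_; refl; sym; trans; cong; subst; subst₂)

module _ {A : Set} where

  removeOne : ∀ {y : A} {ys} → y ∈ ys →
              Σ (List A) λ ys′ → length ys ≡ suc (length ys′) × (∀ {z} → z ∈ ys → z ≢ y → z ∈ ys′)
  removeOne {ys = x ∷ ys} (here refl) = ys , refl , λ { (here refl) z≢y → contradiction refl z≢y
                                                    ; (there z∈ys) _ → z∈ys }
  removeOne {ys = x ∷ ys} (there y∈ys) with removeOne y∈ys
  ... | ys′ , len , keep = x ∷ ys′ , cong suc len , λ { (here refl) _ → here refl
                                                      ; (there z∈ys) z≢y → there (keep z∈ys z≢y) }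

length-≤-injectiveRelation : ∀ {A B : Set} (R : A → B → Set) →
  (∀ {x x′ y} → R x y → R x′ y → x ≡ x′) →
  ∀ {xs ys} → Unique xs → (∀ {x} → x ∈ xs → ∃ λ y → y ∈ ys × R x y) →
  length xs ≤ length ys
length-≤-injectiveRelation R inj {[]} _ _ = z≤n
length-≤-injectiveRelation R inj {x ∷ xs} {ys} (x∉xs ∷ uniq) image
  with image (here refl)
... | y , y∈ys , Rxy with removeOne y∈ys
... | ys′ , len , keep = subst (suc (length xs) ≤_) (sym len)
        (s≤s (length-≤-injectiveRelation R inj uniq imageInYs′))
  where
  imageInYs′ : ∀ {x′} → x′ ∈ xs → ∃ λ y′ → y′ ∈ ys′ × R x′ y′
  imageInYs′ x′∈xs with image (there x′∈xs)
  ... | y′ , y′∈ys , Rx′y′ =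
    y′ , keep y′∈ys (λ { refl → lookup x∉xs x′∈xs (inj Rxy Rx′y′) }) , Rx′y′

indicesBelow : ℕ → (ℕ → Bool) → List ℕ
indicesBelow m p = filterᵇ p (downFrom m)

length-indicesBelow : ∀ m p → length (indicesBelow m p) ≡ count m p
length-indicesBelow zero    p = refl
length-indicesBelow (suc m) p with p m
... | true  = cong suc (length-indicesBelow m p)
... | false = length-indicesBelow m p

count-≤-injectiveRelation : ∀ m p q (R : ℕ → ℕ → Set) →
  (∀ {i i′ j} → R i j → R i′ j → i ≡ i′) →
  (∀ {i} → i < m → T (p i) → ∃ λ j → j < m × T (q j) × R i j) →
  count m p ≤ count m q
count-≤-injectiveRelation m p q R inj image =
  subst₂ _≤_ (length-indicesBelow m p) (length-indicesBelow m q)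
    (length-≤-injectiveRelation R inj (filter⁺ (T? ∘ p) (downFrom⁺ m)) imageOfIndex)
  where
  imageOfIndex : ∀ {i} → i ∈ indicesBelow m p → ∃ λ j → j ∈ indicesBelow m q × R i j
  imageOfIndex i∈ with ∈-filter⁻ (T? ∘ p) i∈
  ... | i∈downFrom , pi with image (∈-downFrom⁻ i∈downFrom) pi
  ... | j , j<m , qj , Rij = j , ∈-filter⁺ (T? ∘ q) (∈-downFrom⁺ j<m) qj , Rij

count-mono : ∀ m p q → (∀ i → T (p i) → T (q i)) → count m p ≤ count m q
count-mono m p q p⇒q = count-≤-injectiveRelation m p q _≡_ (λ { refl refl → refl })
  (λ {i} i<m pi → i , i<m , p⇒q i pi , refl)

count-not+count : ∀ m p → count m (not ∘ p) + count m p ≡ m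
count-not+count zero    p = refl
count-not+count (suc m) p with p m
... | true  = trans (+-suc _ _) (cong suc (count-not+count m p))
... | false = cong suc (count-not+count m p)

T-∨ˡ : ∀ {a} b → T a → T (a ∨ b)
T-∨ˡ {true} _ _ = _

T-∨ʳ : ∀ a {b} → T b → T (a ∨ b)
T-∨ʳ true  _  = _
T-∨ʳ false tb = tb

T-⌊⌋∧⌊⌋ : ∀ {P Q : Set} (p? : Dec P) (q? : Dec Q) → P → Q → T (⌊ p? ⌋ ∧ ⌊ q? ⌋)
T-⌊⌋∧⌊⌋ (yes _)  (yes _)  _ _ = _
T-⌊⌋∧⌊⌋ (no ¬p)  _        p _ = contradiction p ¬p
T-⌊⌋∧⌊⌋ (yes _)  (no ¬q)  _ q = contradiction q ¬q

T-not⇒¬T : ∀ {b} → T (not b) → ¬ T b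
T-not⇒¬T {false} _ ()

T-anyBelow : ∀ m p {l} → l < m → T (p l) → T (anyBelow m p)
T-anyBelow (suc m) p {l} (s≤s l≤m) pl with m≤n⇒m<n∨m≡n l≤m
... | inj₁ l<m  = T-∨ˡ (p m) (T-anyBelow m p l<m pl)
... | inj₂ refl = T-∨ʳ (anyBelow m p) pl

m+m≤n+n⇒m≤n : ∀ {m n} → m + m ≤ n + n → m ≤ n
m+m≤n+n⇒m≤n {m} {n} m+m≤n+n with m ≤? n
... | yes m≤n = m≤n
... | no  m≰n = contradiction m+m≤n+n (<⇒≱ (+-mono-< (≰⇒> m≰n) (≰⇒> m≰n)))

module _ {n : ℕ} (w : Walk n) where

  SameEdge-sym : ∀ {i j} → SameEdge w i j → SameEdge w j i
  SameEdge-sym (inj₁ (a , b)) = inj₁ (sym a , sym b)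
  SameEdge-sym (inj₂ (a , b)) = inj₂ (sym b , sym a)

  SameEdge-trans : ∀ {i j k} → SameEdge w i j → SameEdge w j k → SameEdge w i k
  SameEdge-trans (inj₁ (a , b)) (inj₁ (c , d)) = inj₁ (trans a c , trans b d)
  SameEdge-trans (inj₁ (a , b)) (inj₂ (c , d)) = inj₂ (trans a c , trans b d)
  SameEdge-trans (inj₂ (a , b)) (inj₁ (c , d)) = inj₂ (trans a d , trans b c)
  SameEdge-trans (inj₂ (a , b)) (inj₂ (c , d)) = inj₁ (trans a d , trans b c)

  SameEdge⇒sameEdgeᵇ : ∀ {i j} → SameEdge w i j → T (sameEdgeᵇ w i j)
  SameEdge⇒sameEdgeᵇ {i} {j} (inj₁ (a , b)) =
    T-∨ˡ (⌊ w i ≟ w (suc j) ⌋ ∧ ⌊ w (suc i) ≟ w j ⌋) (T-⌊⌋∧⌊⌋ (w i ≟ w j) (w (suc i) ≟ w (suc j)) a b)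
  SameEdge⇒sameEdgeᵇ {i} {j} (inj₂ (a , b)) =
    T-∨ʳ (⌊ w i ≟ w j ⌋ ∧ ⌊ w (suc i) ≟ w (suc j) ⌋) (T-⌊⌋∧⌊⌋ (w i ≟ w (suc j)) (w (suc i) ≟ w j) a b)

  isStale-laterTraversal : ∀ {i j} → i < j → SameEdge w i j → T (isStale w j)
  isStale-laterTraversal {i} {j} i<j e =
    T-anyBelow j (λ l → sameEdgeᵇ w l j) i<j (SameEdge⇒sameEdgeᵇ e)

  FirstTraversalOf : ℕ → ℕ → Set
  FirstTraversalOf i j = T (not (isStale w i)) × SameEdge w i j

  firstTraversalOf-unique : ∀ {i i′ j} → FirstTraversalOf i j → FirstTraversalOf i′ j → i ≡ i′
  firstTraversalOf-unique {i} {i′} (fresh , e) (fresh′ , e′) with <-cmp i i′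
  ... | tri< i<i′ _ _ = contradiction
          (isStale-laterTraversal i<i′ (SameEdge-trans e (SameEdge-sym e′))) (T-not⇒¬T fresh′)
  ... | tri≈ _ i≡i′ _ = i≡i′
  ... | tri> _ _ i′<i = contradiction
          (isStale-laterTraversal i′<i (SameEdge-trans e′ (SameEdge-sym e))) (T-not⇒¬T fresh)

  count-nonStale≤count-stale : ∀ m → SingletonFree m w →
                               count m (not ∘ isStale w) ≤ count m (isStale w)
  count-nonStale≤count-stale m singletonFree =
    count-≤-injectiveRelation m (not ∘ isStale w) (isStale w) FirstTraversalOf
      firstTraversalOf-unique laterTraversal
    where
    laterTraversal : ∀ {i} → i < m → T (not (isStale w i)) →
                     ∃ λ j → j < m × T (isStale w j) × FirstTraversalOf i j
    laterTraversal {i} i<m nonStale with singletonFree i i<m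
    ... | j , j<m , j≢i , e with <-cmp j i
    ...   | tri< j<i _ _ = contradiction (isStale-laterTraversal j<i (SameEdge-sym e)) (T-not⇒¬T nonStale)
    ...   | tri≈ _ j≡i _ = contradiction j≡i j≢i
    ...   | tri> _ _ i<j = j , j<m , isStale-laterTraversal i<j e , nonStale , e

  isFresh⇒nonStale : ∀ i → T (isFresh w i) → T (not (isStale w i))
  isFresh⇒nonStale i = proj₁ ∘ Equivalence.to (T-∧ {not (isStale w i)})

proposition3p6 : ∀ {n : ℕ} (G : Graph n) (k : ℕ) (w : Walk n)
    → IsHike G k w
    → SingletonFree (k + k) w
    → (k + k ≤ 2 * staleCount (k + k) w) × (freshCount (k + k) w < suc k)
proposition3p6 G k w _ singletonFree = halfStale , s≤s (begin
    freshCount (k + k) w ≤⟨ count-mono (k + k) (isFresh w) (not ∘ isStale w) (isFresh⇒nonStale w) ⟩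
    N                    ≤⟨ N≤k ⟩
    k                    ∎)
  where
  open ≤-Reasoning
  N S : ℕ
  N = count (k + k) (not ∘ isStale w)
  S = staleCount (k + k) w
  N≤S : N ≤ S
  N≤S = count-nonStale≤count-stale w (k + k) singletonFree
  N+S : N + S ≡ k + k
  N+S = count-not+count (k + k) (isStale w)
  N≤k : N ≤ k
  N≤k = m+m≤n+n⇒m≤n (begin
    N + N       ≤⟨ +-monoʳ-≤ N N≤S ⟩
    N + S       ≡⟨ N+S ⟩
    k + k       ∎)
  halfStale : k + k ≤ 2 * S
  halfStale = begin
    k + k       ≡⟨ sym N+S ⟩
    N + S       ≤⟨ +-monoˡ-≤ S N≤S ⟩
    S + S       ≡⟨ cong (S +_) (sym (+-identityʳ S)) ⟩
    2 * S       ∎
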